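{- Let $T_1,T_2$ be nontrivial trees with $n_1$ and $n_2$ vertices respectively, where $n_1\le n_2$. Then $\chi_r(T_1+T_2)=2(r-1)$ for every integer $r$ with $4\le r\le n_1+1$.
   Context: All graphs are simple, connected and undirected. For a vertex $v$, $N_G(v)$ is its open neighborhood and $d(v)=|N_G(v)|$; $\Delta$ is the maximum degree. For a coloring $c$ and vertex set $S$, $c(S)=\{c(u):u\in S\}$. For integers $k>0$ and $0<r\le\Delta(G)$ with $r\le k$, a conditional $(k,r)$-coloring of $G$ is a surjective map $c:V(G)\to\{1,\dots,k\}$ such that (C1) $c(u)\ne c(v)$ whenever $uv\in E(G)$, and (C2) $|c(N_G(v))|\ge\min\{d(v),r\}$ for every vertex $v$. $\chi_r(G)$ is the smallest $k$ for which $G$ has a conditional $(k,r)$-coloring. The join $G_1+G_2$ has vertex set $V(G_1)\cup V(G_2)$ (disjoint) and edge set $E(G_1)\cup E(G_2)\cup\{u_1u_2:u_1\in V(G_1),u_2\in V(G_2)\}$. -}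

module Defs where

open import Data.Nat using (ℕ; zero; suc; _+_; _*_; _∸_; _≤_; _⊓_)
open import Data.Bool using (Bool; true; false; _∧_)
open import Data.Fin using (Fin; splitAt)
import Data.Fin as Fin
open import Data.Sum using (_⊎_; inj₁; inj₂)
open import Data.Product using (Σ; _×_; ∃; ∃-syntax)
open import Data.List using (List; []; _∷_; _++_; [_]; length; filter)
open import Data.Bool.ListAction using (any)
open import Data.List.Relation.Unary.Unique.Propositional using (Unique)
open import Data.List.Relation.Unary.Any using (Any)
open import Data.List.Relation.Unary.All using (All)
open import Data.Fin.Properties using (_≟_)
open import Data.List.Base using (allFin)
open import Relation.Nullary using (¬_)
open import Relation.Nullary.Decidable using (⌊_⌋)
open import Relation.Binary.PropositionalEquality using (_≡_)

record Graph (n : ℕ) : Set where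
  field
    adj   : Fin n → Fin n → Bool
    sym   : ∀ u v → adj u v ≡ adj v u
    irref : ∀ v → adj v v ≡ false
open Graph public

Adj : ∀ {n} → Graph n → Fin n → Fin n → Set
Adj G u v = adj G u v ≡ true

data Reach {n} (G : Graph n) : Fin n → Fin n → Set where
  here : ∀ {v} → Reach G v v
  step : ∀ {u w v} → Adj G u w → Reach G w v → Reach G u v

Connected : ∀ {n} → Graph n → Set
Connected G = ∀ u v → Reach G u v

data Chain {n} (G : Graph n) : List (Fin n) → Set where
  []  : Chain G []
  [-] : ∀ {x} → Chain G (x ∷ [])
  _∷_ : ∀ {x y xs} → Adj G x y → Chain G (y ∷ xs) → Chain G (x ∷ y ∷ xs)

IsCycle : ∀ {n} → Graph n → Fin n → List (Fin n) → Set
IsCycle G x xs = (2 ≤ length xs) × Unique (x ∷ xs) × Chain G (x ∷ xs ++ [ x ])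

Acyclic : ∀ {n} → Graph n → Set
Acyclic G = ∀ x xs → ¬ IsCycle G x xs

Tree : ∀ {n} → Graph n → Set
Tree G = Connected G × Acyclic G

-- join G₁ + G₂ on Fin (n₁ + n₂): first n₁ vertices from G₁, rest from G₂
joinAdj : ∀ {n₁ n₂} → Graph n₁ → Graph n₂ → Fin (n₁ + n₂) → Fin (n₁ + n₂) → Bool
joinAdj {n₁} G₁ G₂ u v with splitAt n₁ u | splitAt n₁ v
... | inj₁ a | inj₁ b = adj G₁ a b
... | inj₂ a | inj₂ b = adj G₂ a b
... | inj₁ _ | inj₂ _ = true
... | inj₂ _ | inj₁ _ = true

joinSym : ∀ {n₁ n₂} (G₁ : Graph n₁) (G₂ : Graph n₂) u v →
          joinAdj G₁ G₂ u v ≡ joinAdj G₁ G₂ v u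
joinSym {n₁} G₁ G₂ u v with splitAt n₁ u | splitAt n₁ v
... | inj₁ a | inj₁ b = sym G₁ a b
... | inj₂ a | inj₂ b = sym G₂ a b
... | inj₁ _ | inj₂ _ = Relation.Binary.PropositionalEquality.refl
... | inj₂ _ | inj₁ _ = Relation.Binary.PropositionalEquality.refl

joinIrref : ∀ {n₁ n₂} (G₁ : Graph n₁) (G₂ : Graph n₂) v → joinAdj G₁ G₂ v v ≡ false
joinIrref {n₁} G₁ G₂ v with splitAt n₁ v
... | inj₁ a = irref G₁ a
... | inj₂ a = irref G₂ a

_⊕_ : ∀ {n₁ n₂} → Graph n₁ → Graph n₂ → Graph (n₁ + n₂)
G₁ ⊕ G₂ = record { adj = joinAdj G₁ G₂ ; sym = joinSym G₁ G₂ ; irref = joinIrref G₁ G₂ }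

degree : ∀ {n} → Graph n → Fin n → ℕ
degree {n} G v = length (filter (λ u → adj G v u Data.Bool.≟ true) (allFin n))

nbColours : ∀ {n k} → Graph n → (Fin n → Fin k) → Fin n → ℕ
nbColours {n} {k} G c v =
  length (filter (λ a → any (λ u → adj G v u ∧ ⌊ c u ≟ a ⌋) (allFin n) Data.Bool.≟ true)
                 (allFin k))

record CondColouring {n} (G : Graph n) (k r : ℕ) : Set where
  field
    colour   : Fin n → Fin k
    r≤k      : r ≤ k
    surj     : ∀ a → ∃[ v ] colour v ≡ a
    proper   : ∀ u v → Adj G u v → ¬ colour u ≡ colour v
    cond     : ∀ v → degree G v ⊓ r ≤ nbColours G colour v

ChiR≡ : ∀ {n} → Graph n → ℕ → ℕ → Set
ChiR≡ G r m = CondColouring G m r × (∀ k → CondColouring G k r → m ≤ k)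

module Submission where

-- Write m = r ∸ 1.  For the upper bound, colour each tree properly with exactly m
-- colours (a tree is bipartite, and while fewer colours than vertices are in use a new
-- colour can be given to one vertex of a repeated colour class), with disjoint palettes
-- on the two sides of the join: every vertex then sees the m colours of the other side
-- and the colour of a neighbour on its own side, r in all.  For the lower bound, the two
-- sides of the join carry disjoint colour sets.  A leaf of T₁ has degree 1 + n₂ ≥ r, so
-- it sees r colours, and all of them but its neighbour's occur on T₂; so T₂ carries at
-- least m colours, T₁ does too by symmetry, and k ≥ 2m.

open import Defs hiding (sym)
open import Data.Nat using (ℕ; zero; suc; _+_; _*_; _∸_; _≤_; _<_; _≤′_; ≤′-reflexive; ≤′-step; z≤n; s≤s; parity)
open import Data.Nat.Properties
  using (≤-trans; ≤-pred; n≤1+n; <⇒≤; ≤⇒≯; ≰⇒>; ≤⇒≤′; m≤n⇒m≤1+n; m<m+n; m<n+m; +-suc; +-comm; +-identityʳ;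
         +-mono-≤; +-monoˡ-≤; m⊓n≤n; m≥n⇒m⊓n≡n)
import Data.Nat.Properties as ℕ
open import Data.Nat.Induction using (<-wellFounded)
open import Data.Nat.Tactic.RingSolver using (solve-∀)
open import Data.Parity using (Parity; 0ℙ; 1ℙ; _⁻¹) renaming (_+_ to _⊕ℙ_)
open import Data.Parity.Properties using (+-homo-+; p+p⁻¹≡1ℙ)
open import Data.Bool using (Bool; true; false; not; _∧_)
import Data.Bool as Bool
open import Data.Bool.ListAction using (any)
open import Data.Fin using (Fin; zero; suc; _↑ˡ_; _↑ʳ_; splitAt; join)
open import Data.Fin.Properties
  using (_≟_; any?; injective⇒≤; pigeonhole; <⇒≢; suc-injective; ↑ˡ-injective; ↑ʳ-injective;
         splitAt-↑ˡ; splitAt-↑ʳ; splitAt⁻¹-↑ˡ; splitAt⁻¹-↑ʳ)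
open import Data.Vec.Functional using () renaming (_∷_ to _◂_)
open import Data.List using (List; []; _∷_; _++_; [_]; length; filter; lookup; allFin)
open import Data.List.Properties using (length-++; length-++-≤ˡ; length-++-comm; ++-assoc; length-tabulate)
open import Data.List.Membership.Propositional using (_∈_)
open import Data.List.Membership.Propositional.Properties using (∈-filter⁺; ∈-allFin; ∈-lookup; ∈-∃++)
import Data.List.Membership.DecPropositional as DecMembership
open import Data.List.Relation.Unary.All as All using ([]; _∷_)
open import Data.List.Relation.Unary.All.Properties using (¬Any⇒All¬; ++⁻ˡ)
open import Data.List.Relation.Unary.Any using (here; there; index)
open import Data.List.Relation.Unary.Any.Properties using (lookup-index)
open import Data.List.Relation.Unary.AllPairs using ([]; _∷_)
open import Data.List.Relation.Unary.Unique.Propositional using (Unique)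
open import Data.List.Relation.Unary.Unique.Propositional.Properties using (allFin⁺)
open import Data.List.Relation.Unary.Unique.DecPropositional using (unique?)
open import Data.Product using (∃; ∃-syntax; ∃₂; _×_; _,_; proj₁; proj₂)
open import Data.Sum using (_⊎_; inj₁; inj₂; [_,_]′)
import Data.Sum as Sum
open import Data.Empty using (⊥; ⊥-elim)
open import Function using (_∘_; const)
open import Function.Definitions using (Injective)
open import Induction.WellFounded using (Acc; acc)
open import Relation.Nullary using (¬_; Dec; yes; no; ¬?; _×-dec_; contradiction)
open import Relation.Nullary.Decidable using (⌊_⌋; decidable-stable)
open import Relation.Binary.PropositionalEquality
  using (_≡_; _≢_; refl; sym; trans; cong; cong₂; subst; setoid; module ≡-Reasoning)

-- Counting

-- degree and nbColours in Defs are counts of this form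
count : ∀ {A : Set} → (A → Bool) → List A → ℕ
count b xs = length (filter (λ x → b x Bool.≟ true) xs)

count-injection : ∀ {n r} {b : Fin n → Bool} (f : Fin r → Fin n) →
                  Injective _≡_ _≡_ f → (∀ i → b (f i) ≡ true) → r ≤ count b (allFin n)
count-injection {n} {b = b} f f-inj bf = injective⇒≤ index-injective
  where
  accepted : List (Fin n)
  accepted = filter (λ x → b x Bool.≟ true) (allFin n)
  member : ∀ i → f i ∈ accepted
  member i = ∈-filter⁺ (λ x → b x Bool.≟ true) (∈-allFin (f i)) (bf i)
  index-injective : Injective _≡_ _≡_ (λ i → index (member i))
  index-injective {i} {j} eq = f-inj (trans (lookup-index (member i))
    (trans (cong (lookup accepted) eq) (sym (lookup-index (member j)))))

count-mono : ∀ {A : Set} {p q : A → Bool} xs →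
             (∀ {x} → x ∈ xs → p x ≡ true → q x ≡ true) → count p xs ≤ count q xs
count-mono [] _ = z≤n
count-mono {p = p} {q} (x ∷ xs) p⊆q with p x in px | q x in qx
... | true  | true  = s≤s (count-mono xs (λ m → p⊆q (there m)))
... | true  | false with () ← trans (sym (p⊆q (here refl) px)) qx
... | false | true  = m≤n⇒m≤1+n (count-mono xs (λ m → p⊆q (there m)))
... | false | false = count-mono xs (λ m → p⊆q (there m))

count-≤-suc : ∀ {A : Set} {p q : A → Bool} (x₀ : A) xs → Unique xs →
              (∀ {x} → p x ≡ true → q x ≡ true ⊎ x ≡ x₀) → count p xs ≤ suc (count q xs)
count-≤-suc x₀ [] _ _ = z≤n
count-≤-suc {p = p} {q} x₀ (x ∷ xs) (x∉xs ∷ xs!) p⊆q∪x₀ with p x in px | q x in qx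
... | true  | true  = s≤s (count-≤-suc x₀ xs xs! p⊆q∪x₀)
... | false | true  = m≤n⇒m≤1+n (count-≤-suc x₀ xs xs! p⊆q∪x₀)
... | false | false = count-≤-suc x₀ xs xs! p⊆q∪x₀
... | true  | false = s≤s (count-mono xs p⊆q)
  where
  x≡x₀ : x ≡ x₀
  x≡x₀ with p⊆q∪x₀ px
  ... | inj₁ qx′ with () ← trans (sym qx′) qx
  ... | inj₂ eq = eq
  p⊆q : ∀ {y} → y ∈ xs → p y ≡ true → q y ≡ true
  p⊆q {y} y∈xs py with p⊆q∪x₀ py
  ... | inj₁ qy = qy
  ... | inj₂ refl = ⊥-elim (All.lookup x∉xs y∈xs x≡x₀)

count-disjoint : ∀ {A : Set} {p q : A → Bool} xs →
                 (∀ {x} → p x ≡ true → q x ≡ true → ⊥) → count p xs + count q xs ≤ length xs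
count-disjoint [] _ = z≤n
count-disjoint {p = p} {q} (x ∷ xs) p∩q=∅ with p x in px | q x in qx
... | true  | true  = ⊥-elim (p∩q=∅ px qx)
... | true  | false = s≤s (count-disjoint xs p∩q=∅)
... | false | true  = subst (_≤ suc (length xs)) (sym (+-suc (count p xs) (count q xs)))
                            (s≤s (count-disjoint xs p∩q=∅))
... | false | false = m≤n⇒m≤1+n (count-disjoint xs p∩q=∅)

any≡true⁺ : ∀ {A : Set} (p : A → Bool) {x xs} → x ∈ xs → p x ≡ true → any p xs ≡ true
any≡true⁺ p (here refl) px rewrite px = refl
any≡true⁺ p {xs = y ∷ _} (there x∈xs) px with p y
... | true  = refl
... | false = any≡true⁺ p x∈xs px

any≡true⁻ : ∀ {A : Set} (p : A → Bool) xs → any p xs ≡ true → ∃[ x ] p x ≡ true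
any≡true⁻ p (x ∷ xs) h with p x in px
... | true  = x , px
... | false = any≡true⁻ p xs h

◂-injective : ∀ {A : Set} {r} {x : A} {f : Fin r → A} →
              Injective _≡_ _≡_ f → (∀ i → f i ≢ x) → Injective _≡_ _≡_ (x ◂ f)
◂-injective f-inj fresh {zero}  {zero}  _  = refl
◂-injective f-inj fresh {zero}  {suc j} eq = contradiction (sym eq) (fresh j)
◂-injective f-inj fresh {suc i} {zero}  eq = contradiction eq (fresh i)
◂-injective f-inj fresh {suc i} {suc j} eq = cong suc (f-inj eq)

Unique⇒lookup-injective : ∀ {A : Set} {xs : List A} → Unique xs → Injective _≡_ _≡_ (lookup xs)
Unique⇒lookup-injective {xs = _ ∷ _} _            {zero}  {zero}  _  = refl
Unique⇒lookup-injective {xs = _ ∷ _} (x∉xs ∷ _)   {zero}  {suc j} eq = ⊥-elim (All.lookup x∉xs (∈-lookup j) eq)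
Unique⇒lookup-injective {xs = _ ∷ _} (x∉xs ∷ _)   {suc i} {zero}  eq = ⊥-elim (All.lookup x∉xs (∈-lookup i) (sym eq))
Unique⇒lookup-injective {xs = _ ∷ _} (_ ∷ xs!)    {suc i} {suc j} eq = cong suc (Unique⇒lookup-injective xs! eq)

Unique⇒length≤ : ∀ {n} {xs : List (Fin n)} → Unique xs → length xs ≤ n
Unique⇒length≤ xs! = injective⇒≤ (Unique⇒lookup-injective xs!)

Unique-++⁻ˡ : ∀ {A : Set} (xs : List A) {ys} → Unique (xs ++ ys) → Unique xs
Unique-++⁻ˡ []       _             = []
Unique-++⁻ˡ (x ∷ xs) (x∉xs ∷ xs!) = ++⁻ˡ xs x∉xs ∷ Unique-++⁻ˡ xs xs!

Unique-rotate : ∀ {A : Set} (xs : List A) x → Unique (xs ++ [ x ]) → Unique (x ∷ xs)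
Unique-rotate {A} xs x = Unique-resp-↭ (↭-sym (∷↭∷ʳ x xs))
  where
  open import Data.List.Relation.Binary.Permutation.Setoid (setoid A) using (↭-sym)
  open import Data.List.Relation.Binary.Permutation.Setoid.Properties (setoid A) using (Unique-resp-↭; ∷↭∷ʳ)

¬Unique⇒repetition : ∀ {n} (xs : List (Fin n)) → ¬ Unique xs →
                      ∃₂ λ as p → ∃₂ λ bs cs → xs ≡ as ++ p ∷ bs ++ p ∷ cs
¬Unique⇒repetition []       ¬xs! = ⊥-elim (¬xs! [])
¬Unique⇒repetition (x ∷ xs) ¬xs! with DecMembership._∈?_ _≟_ x xs
... | yes x∈xs = let bs , cs , xs≡ = ∈-∃++ x∈xs in [] , x , bs , cs , cong (x ∷_) xs≡
... | no  x∉xs = let as , p , bs , cs , xs≡ = ¬Unique⇒repetition xs (λ xs! → ¬xs! (¬Any⇒All¬ xs x∉xs ∷ xs!))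
                 in x ∷ as , p , bs , cs , cong (x ∷_) xs≡

0<length-++∷ : ∀ {A : Set} (xs : List A) {y ys} → 0 < length (xs ++ y ∷ ys)
0<length-++∷ []      = s≤s z≤n
0<length-++∷ (_ ∷ _) = s≤s z≤n

length-loop : ∀ {A : Set} as (p : A) bs cs →
              length (as ++ p ∷ bs ++ p ∷ cs) ≡ length (bs ++ [ p ]) + length ((as ++ [ p ]) ++ cs)
length-loop as p bs cs = begin
  length (as ++ p ∷ bs ++ p ∷ cs)                      ≡⟨ length-++ as ⟩
  length as + suc (length (bs ++ p ∷ cs))              ≡⟨ cong (λ l → length as + suc l) (length-++ bs) ⟩
  length as + suc (length bs + suc (length cs))        ≡⟨ rearrange (length as) (length bs) (length cs) ⟩
  (length bs + 1) + ((length as + 1) + length cs)      ≡⟨ cong₂ _+_ (length-++ bs) |as++p++cs| ⟨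
  length (bs ++ [ p ]) + length ((as ++ [ p ]) ++ cs)  ∎
  where
  open ≡-Reasoning
  |as++p++cs| : length ((as ++ [ p ]) ++ cs) ≡ (length as + 1) + length cs
  |as++p++cs| = trans (length-++ (as ++ [ p ])) (cong (_+ length cs) (length-++ as))
  rearrange : ∀ a b c → a + suc (b + suc c) ≡ (b + 1) + ((a + 1) + c)
  rearrange = solve-∀

-- Walks and acyclic graphs

Adj-sym : ∀ {n} (G : Graph n) {u v} → Adj G u v → Adj G v u
Adj-sym G {u} {v} e = trans (Graph.sym G v u) e

Adj-irrefl : ∀ {n} (G : Graph n) {v} → ¬ Adj G v v
Adj-irrefl G {v} e with () ← trans (sym (irref G v)) e

first-step : ∀ {n} {G : Graph n} {u v} → Reach G u v → u ≢ v → ∃[ w ] Adj G u w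
first-step here       u≢u = ⊥-elim (u≢u refl)
first-step (step e _) _   = _ , e

neighbour : ∀ {n} {G : Graph n} → Connected G → 2 ≤ n → ∀ v → ∃[ u ] Adj G v u
neighbour connected (s≤s (s≤s z≤n)) zero    = first-step (connected zero (suc zero)) (λ ())
neighbour connected (s≤s (s≤s z≤n)) (suc v) = first-step (connected (suc v) zero) (λ ())

-- Walk G u vs v: a walk from u to v whose vertices after u are, in order, vs
data Walk {n} (G : Graph n) : Fin n → List (Fin n) → Fin n → Set where
  []  : ∀ {u} → Walk G u [] u
  _∷_ : ∀ {u w vs v} → Adj G u w → Walk G w vs v → Walk G u (w ∷ vs) v

module _ {n} {G : Graph n} where

  reach⇒walk : ∀ {u v} → Reach G u v → ∃[ vs ] Walk G u vs v
  reach⇒walk here       = [] , []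
  reach⇒walk (step e r) = let vs , w = reach⇒walk r in _ , e ∷ w

  _++ʷ_ : ∀ {u vs w ws v} → Walk G u vs w → Walk G w ws v → Walk G u (vs ++ ws) v
  []      ++ʷ w′ = w′
  (e ∷ w) ++ʷ w′ = e ∷ (w ++ʷ w′)

  walk-reverse : ∀ {u vs v} → Walk G u vs v → ∃[ vs′ ] length vs′ ≡ length vs × Walk G v vs′ u
  walk-reverse []       = [] , refl , []
  walk-reverse {u} (e ∷ wk) =
    let vs′ , |vs′| , wk′ = walk-reverse wk
    in vs′ ++ [ u ] , trans (length-++-comm vs′ [ u ]) (cong suc |vs′|) , wk′ ++ʷ (Adj-sym G e ∷ [])

  walk⇒chain : ∀ {u vs v} → Walk G u vs v → Chain G (u ∷ vs)
  walk⇒chain []      = [-]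
  walk⇒chain (e ∷ w) = e ∷ walk⇒chain w

  walk-last : ∀ {u vs v} → Walk G u vs v → vs ≡ [] ⊎ ∃[ xs ] vs ≡ xs ++ [ v ]
  walk-last []       = inj₁ refl
  walk-last (_ ∷ []) = inj₂ ([] , refl)
  walk-last (_∷_ {w = w} _ wk@(_ ∷ _)) with walk-last wk
  ... | inj₂ (xs , eq) = inj₂ (w ∷ xs , cong (w ∷_) eq)

  walk-split : ∀ {u v} as p bs → Walk G u (as ++ p ∷ bs) v → Walk G u (as ++ [ p ]) p × Walk G p bs v
  walk-split []       p bs (e ∷ wk) = e ∷ [] , wk
  walk-split (a ∷ as) p bs (e ∷ wk) = let w₁ , w₂ = walk-split as p bs wk in e ∷ w₁ , w₂

module _ {n} {G : Graph n} (acyclic : Acyclic G) where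

  uniqueClosedWalk-length≤2 : ∀ {x ws} → Walk G x ws x → Unique ws → length ws ≤ 2
  uniqueClosedWalk-length≤2 {x} wk ws! with walk-last wk
  ... | inj₁ refl        = z≤n
  ... | inj₂ (xs , refl) with 2 ℕ.≤? length xs
  ...   | yes 2≤|xs| = ⊥-elim (acyclic x xs (2≤|xs| , Unique-rotate xs x ws! , walk⇒chain wk))
  ...   | no  2≰|xs| = subst (_≤ 2) (sym (length-++-comm xs [ x ])) (≰⇒> 2≰|xs|)

  -- A closed walk through a vertex twice splits into two shorter closed walks; one through
  -- no vertex twice has length at most 2 (a longer one would be a cycle).
  closedWalk-even : ∀ {x ws} → Walk G x ws x → parity (length ws) ≡ 0ℙ
  closedWalk-even {ws = ws} wk = go wk (<-wellFounded (length ws))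
    where
    short-even : ∀ {x ws} → Walk G x ws x → length ws ≤ 2 → parity (length ws) ≡ 0ℙ
    short-even []                _ = refl
    short-even (e ∷ [])          _ = ⊥-elim (Adj-irrefl G e)
    short-even (_ ∷ _ ∷ [])      _ = refl
    short-even (_ ∷ _ ∷ _ ∷ _) (s≤s (s≤s ()))

    go : ∀ {x ws} → Walk G x ws x → Acc _<_ (length ws) → parity (length ws) ≡ 0ℙ
    go {ws = ws} wk (acc smaller) with unique? _≟_ ws
    ... | yes ws! = short-even wk (uniqueClosedWalk-length≤2 wk ws!)
    ... | no ¬ws! with ¬Unique⇒repetition ws ¬ws!
    ... | as , p , bs , cs , refl = begin
      parity L                 ≡⟨ cong parity L≡ ⟩
      parity (L₂ + L₁₃)        ≡⟨ +-homo-+ L₂ L₁₃ ⟩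
      parity L₂ ⊕ℙ parity L₁₃  ≡⟨ cong₂ _⊕ℙ_ (go w₂ (smaller L₂<L)) (go (w₁ ++ʷ w₃) (smaller L₁₃<L)) ⟩
      0ℙ                       ∎
      where
      open ≡-Reasoning
      w₁ : Walk G _ (as ++ [ p ]) p
      w₁ = proj₁ (walk-split as p (bs ++ p ∷ cs) wk)
      w₂₃ : Walk G p (bs ++ p ∷ cs) _
      w₂₃ = proj₂ (walk-split as p (bs ++ p ∷ cs) wk)
      w₂ : Walk G p (bs ++ [ p ]) p
      w₂ = proj₁ (walk-split bs p cs w₂₃)
      w₃ : Walk G p cs _
      w₃ = proj₂ (walk-split bs p cs w₂₃)
      L L₂ L₁₃ : ℕ
      L   = length (as ++ p ∷ bs ++ p ∷ cs)
      L₂  = length (bs ++ [ p ])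
      L₁₃ = length ((as ++ [ p ]) ++ cs)
      L≡ : L ≡ L₂ + L₁₃
      L≡ = length-loop as p bs cs
      L₂<L : L₂ < L
      L₂<L = subst (L₂ <_) (sym L≡) (m<m+n L₂ (≤-trans (0<length-++∷ as) (length-++-≤ˡ (as ++ [ p ]))))
      L₁₃<L : L₁₃ < L
      L₁₃<L = subst (L₁₃ <_) (sym L≡) (m<n+m L₁₃ (0<length-++∷ bs))

Leaf : ∀ {n} → Graph n → Fin n → Set
Leaf G v = ∀ {u w} → Adj G v u → Adj G v w → u ≡ w

Branching : ∀ {n} → Graph n → Fin n → Set
Branching G v = ∃₂ λ u w → Adj G v u × Adj G v w × u ≢ w

module _ {n} (G : Graph n) where

  branching? : ∀ v → Dec (Branching G v)
  branching? v = any? λ u → any? λ w → (adj G v u Bool.≟ true) ×-dec (adj G v w Bool.≟ true) ×-dec ¬? (u ≟ w)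

  ¬Branching⇒Leaf : ∀ {v} → ¬ Branching G v → Leaf G v
  ¬Branching⇒Leaf ¬b {u} {w} vu vw = decidable-stable (u ≟ w) (λ u≢w → ¬b (u , w , vu , vw , u≢w))

-- If every vertex is branching, a path of distinct vertices can always be extended at its
-- head y: y has a neighbour t other than the next vertex z, and t cannot lie further on
-- the path without closing a cycle.
module _ {n} {G : Graph n} (acyclic : Acyclic G) (branching : ∀ v → Branching G v) where

  private
    next : ∀ y z → ∃[ t ] Adj G y t × t ≢ z
    next y z with branching y
    ... | u , w , yu , yw , u≢w with u ≟ z
    ...   | yes refl = w , yw , λ w≡u → u≢w (sym w≡u)
    ...   | no  u≢z  = u , yu , u≢z

  longPath : Fin n → ∀ d → ∃₂ λ y z → ∃₂ λ ps e → Walk G y (z ∷ ps) e × Unique (y ∷ z ∷ ps) × d ≤ length ps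
  longPath v zero =
    let u , _ , vu , _ = branching v
        u≢v = λ u≡v → Adj-irrefl G (subst (Adj G v) u≡v vu)
    in u , v , [] , v , Adj-sym G vu ∷ [] , (u≢v ∷ []) ∷ [] ∷ [] , z≤n
  longPath v (suc d) with longPath v d
  ... | y , z , ps , e , wk , y∷z∷ps! , d≤|ps| with next y z
  ... | t , yt , t≢z with DecMembership._∈?_ _≟_ t ps
  ... | no t∉ps = t , y , z ∷ ps , e , Adj-sym G yt ∷ wk ,
                  (t≢y ∷ t≢z ∷ ¬Any⇒All¬ ps t∉ps) ∷ y∷z∷ps! , s≤s d≤|ps|
    where
    t≢y : t ≢ y
    t≢y t≡y = Adj-irrefl G (subst (Adj G y) t≡y yt)
  ... | yes t∈ps with ∈-∃++ t∈ps
  ... | pre , post , refl = ⊥-elim (too-long (uniqueClosedWalk-length≤2 acyclic cycle cycle!))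
    where
    cycle : Walk G t (y ∷ z ∷ pre ++ [ t ]) t
    cycle = Adj-sym G yt ∷ proj₁ (walk-split (z ∷ pre) t post wk)
    cycle! : Unique (y ∷ z ∷ pre ++ [ t ])
    cycle! = Unique-++⁻ˡ (y ∷ z ∷ pre ++ [ t ])
               (subst Unique (cong (λ l → y ∷ z ∷ l) (sym (++-assoc pre [ t ] post))) y∷z∷ps!)
    too-long : ¬ length (y ∷ z ∷ pre ++ [ t ]) ≤ 2
    too-long (s≤s (s≤s |pre++t|≤0)) with () ← ≤-trans (0<length-++∷ pre) |pre++t|≤0

acyclic⇒leaf : ∀ {n} {G : Graph n} → Acyclic G → Fin n → ∃ (Leaf G)
acyclic⇒leaf {n} {G} acyclic v with any? (λ u → ¬? (branching? G u))
... | yes (u , ¬b) = u , ¬Branching⇒Leaf G ¬b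
... | no ∄leaf =
  let _ , _ , _ , _ , _ , path! , n≤|ps| = longPath acyclic allBranching v n
  in ⊥-elim (≤⇒≯ n≤|ps| (<⇒≤ (Unique⇒length≤ path!)))
  where
  allBranching : ∀ u → Branching G u
  allBranching u = decidable-stable (branching? G u) (λ ¬b → ∄leaf (u , ¬b))

tree-pendant : ∀ {n} {G : Graph n} → Tree G → 2 ≤ n → ∃₂ λ ℓ w → Leaf G ℓ × Adj G ℓ w
tree-pendant (connected , acyclic) 2≤n@(s≤s _) =
  let ℓ , leaf = acyclic⇒leaf acyclic zero
      w , ℓw   = neighbour connected 2≤n ℓ
  in ℓ , w , leaf , ℓw

-- Colourings of trees

record ExactColouring {n} (G : Graph n) (k : ℕ) : Set where
  field
    colour     : Fin n → Fin k
    proper     : ∀ {u v} → Adj G u v → colour u ≢ colour v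
    surjective : ∀ a → ∃[ v ] colour v ≡ a

module Bipartition {n} {G : Graph n} (connected : Connected G) (acyclic : Acyclic G) (root : Fin n) where

  -- parity of the length of some walk from the root; any walk will do since closed walks are even
  side : Fin n → Parity
  side v = parity (length (proj₁ (reach⇒walk (connected root v))))

  side-root : side root ≡ 0ℙ
  side-root = closedWalk-even acyclic (proj₂ (reach⇒walk (connected root root)))

  side-proper : ∀ {u v} → Adj G u v → side u ≢ side v
  side-proper {u} {v} e su≡sv with reach⇒walk (connected root u) | reach⇒walk (connected root v)
  ... | us , wu | vs , wv with walk-reverse wv
  ... | vs′ , |vs′| , wv′ = contradiction 1ℙ≡0ℙ λ ()
    where
    open ≡-Reasoning
    1ℙ≡0ℙ : 1ℙ ≡ 0ℙ
    1ℙ≡0ℙ = begin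
        1ℙ                                           ≡⟨ p+p⁻¹≡1ℙ (parity (length us)) ⟨
        parity (length us) ⊕ℙ parity (length us) ⁻¹  ≡⟨ cong (λ p → parity (length us) ⊕ℙ p ⁻¹) su≡sv ⟩
        parity (length us) ⊕ℙ parity (length vs) ⁻¹  ≡⟨ cong (λ l → parity (length us) ⊕ℙ parity l ⁻¹) |vs′| ⟨
        parity (length us) ⊕ℙ parity (length vs′) ⁻¹ ≡⟨ cong (parity (length us) ⊕ℙ_) (+-homo-+ 1 (length vs′)) ⟨
        parity (length us) ⊕ℙ parity (suc (length vs′))  ≡⟨ +-homo-+ (length us) (suc (length vs′)) ⟨
        parity (length us + suc (length vs′))        ≡⟨ cong parity (length-++ us) ⟨
        parity (length (us ++ v ∷ vs′))              ≡⟨ closedWalk-even acyclic (wu ++ʷ (e ∷ wv′)) ⟩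
        0ℙ                                           ∎

parityColour : Parity → Fin 2
parityColour 0ℙ = zero
parityColour 1ℙ = suc zero

parityColour-injective : Injective _≡_ _≡_ parityColour
parityColour-injective {0ℙ} {0ℙ} _ = refl
parityColour-injective {1ℙ} {1ℙ} _ = refl

tree-2-colouring : ∀ {n} {G : Graph n} → Tree G → 2 ≤ n → ExactColouring G 2
tree-2-colouring {G = G} (connected , acyclic) 2≤n@(s≤s (s≤s z≤n)) = record
  { colour     = λ v → parityColour (side v)
  ; proper     = λ e → side-proper e ∘ parityColour-injective
  ; surjective = surjective
  }
  where
  open Bipartition connected acyclic zero
  surjective : ∀ a → ∃[ v ] parityColour (side v) ≡ a
  surjective zero       = zero , cong parityColour side-root
  surjective (suc zero) with neighbour connected 2≤n zero
  ... | w , e with side w in sw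
  ...   | 1ℙ = w , cong parityColour sw
  ...   | 0ℙ = ⊥-elim (side-proper e (trans side-root (sym sw)))

exactColouring-suc : ∀ {n k} {G : Graph n} → ExactColouring G k → k < n → ExactColouring G (suc k)
exactColouring-suc {n} {k} {G} C k<n with pigeonhole k<n (ExactColouring.colour C)
... | i , j , i<j , cᵢ≡cⱼ = record { colour = colour′ ; proper = proper′ ; surjective = surjective′ }
  where
  open ExactColouring C
  colour′ : Fin n → Fin (suc k)
  colour′ v with v ≟ j
  ... | yes _ = zero
  ... | no  _ = suc (colour v)

  colour′-j : colour′ j ≡ zero
  colour′-j with j ≟ j
  ... | yes _   = refl
  ... | no  j≢j = contradiction refl j≢j

  colour′-≢j : ∀ {v} → v ≢ j → colour′ v ≡ suc (colour v)
  colour′-≢j {v} v≢j with v ≟ j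
  ... | yes v≡j = contradiction v≡j v≢j
  ... | no  _   = refl

  proper′ : ∀ {u v} → Adj G u v → colour′ u ≢ colour′ v
  proper′ {u} {v} e with u ≟ j | v ≟ j
  ... | yes refl | yes refl = λ _ → Adj-irrefl G e
  ... | yes _    | no  _    = λ ()
  ... | no  _    | yes _    = λ ()
  ... | no  _    | no  _    = proper e ∘ suc-injective

  surjective′ : ∀ a → ∃[ v ] colour′ v ≡ a
  surjective′ zero    = j , colour′-j
  surjective′ (suc a) with surjective a
  ... | v , cv≡a with v ≟ j
  ...   | no  v≢j  = v , trans (colour′-≢j v≢j) (cong suc cv≡a)
  ...   | yes refl = i , trans (colour′-≢j (<⇒≢ i<j)) (cong suc (trans cᵢ≡cⱼ cv≡a))

exactColouring-≤′ : ∀ {n k m} {G : Graph n} → ExactColouring G k → k ≤′ m → m ≤ n → ExactColouring G m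
exactColouring-≤′ C (≤′-reflexive refl) _   = C
exactColouring-≤′ C (≤′-step k≤′m)      m<n = exactColouring-suc (exactColouring-≤′ C k≤′m (<⇒≤ m<n)) m<n

tree-exactColouring : ∀ {n m} {G : Graph n} → Tree G → 2 ≤ m → m ≤ n → ExactColouring G m
tree-exactColouring tree 2≤m m≤n = exactColouring-≤′ (tree-2-colouring tree (≤-trans 2≤m m≤n)) (≤⇒≤′ 2≤m) m≤n

-- nbColours G c v is #colours c (adj G v) by definition
usedOn : ∀ {N k} → (Fin N → Fin k) → (Fin N → Bool) → Fin k → Bool
usedOn c S a = any (λ u → S u ∧ ⌊ c u ≟ a ⌋) (allFin _)

#colours : ∀ {N k} → (Fin N → Fin k) → (Fin N → Bool) → ℕ
#colours {k = k} c S = count (usedOn c S) (allFin k)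

module _ {N k} {c : Fin N → Fin k} where

  usedOn⁺ : ∀ {S} {u} → S u ≡ true → usedOn c S (c u) ≡ true
  usedOn⁺ {S} {u} Su = any≡true⁺ _ (∈-allFin u) coloured
    where
    coloured : S u ∧ ⌊ c u ≟ c u ⌋ ≡ true
    coloured rewrite Su with c u ≟ c u
    ... | yes _    = refl
    ... | no cu≢cu = contradiction refl cu≢cu

  usedOn⁻ : ∀ {S} {a} → usedOn c S a ≡ true → ∃[ u ] S u ≡ true × c u ≡ a
  usedOn⁻ {S} {a} h with any≡true⁻ _ (allFin N) h
  ... | u , Su∧cu≡a with S u in Su | c u ≟ a
  ...   | true | yes cu≡a = u , Su , cu≡a

  #colours-injection : ∀ {S} {r} (g : Fin r → Fin k) → Injective _≡_ _≡_ g →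
                       (∀ i → ∃[ u ] S u ≡ true × c u ≡ g i) → r ≤ #colours c S
  #colours-injection {S} g g-inj hit = count-injection g g-inj λ i →
    let u , Su , cu≡gi = hit i in subst (λ a → usedOn c S a ≡ true) cu≡gi (usedOn⁺ {S} Su)

  #colours-≤-suc : ∀ {S} {S′ w} → (∀ {u} → S u ≡ true → S′ u ≡ true ⊎ u ≡ w) → #colours c S ≤ suc (#colours c S′)
  #colours-≤-suc {S} {S′} {w} S⊆S′∪w = count-≤-suc (c w) (allFin k) (allFin⁺ k) λ used →
    let u , Su , cu≡a = usedOn⁻ {S} used in
    [ (λ S′u → inj₁ (subst (λ a → usedOn c S′ a ≡ true) cu≡a (usedOn⁺ {S = S′} S′u)))
    , (λ u≡w → inj₂ (trans (sym cu≡a) (cong c u≡w))) ]′ (S⊆S′∪w Su)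

  #colours-disjoint : ∀ {S} {S′} → (∀ {u u′} → S u ≡ true → S′ u′ ≡ true → c u ≢ c u′) →
                      #colours c S + #colours c S′ ≤ k
  #colours-disjoint {S} {S′} S#S′ =
    subst (#colours c S + #colours c S′ ≤_) (length-tabulate (λ a → a))
      (count-disjoint (allFin k) λ usedS usedS′ →
        let u , Su , cu≡a = usedOn⁻ {S} usedS ; u′ , S′u′ , cu′≡a = usedOn⁻ {S = S′} usedS′
        in S#S′ Su S′u′ (trans cu≡a (sym cu′≡a)))

module _ {N k r} {H : Graph N} (C : CondColouring H k r) where
  open CondColouring C

  cond-saturated : ∀ {v} → r ≤ degree H v → r ≤ nbColours H colour v
  cond-saturated {v} r≤d = subst (_≤ nbColours H colour v) (m≥n⇒m⊓n≡n r≤d) (cond v)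

-- of the r colours that v must see, only the colour of w can be missing from S
#colours-nearLeaf : ∀ {N k m} {H : Graph N} (C : CondColouring H k (suc m)) {v w} {S : Fin N → Bool} →
                    suc m ≤ degree H v → (∀ {u} → Adj H v u → S u ≡ true ⊎ u ≡ w) →
                    m ≤ #colours (CondColouring.colour C) S
#colours-nearLeaf {H = H} C {v} r≤d nbhd =
  ≤-pred (≤-trans (cond-saturated C r≤d) (#colours-≤-suc {c = CondColouring.colour C} {S = adj H v} nbhd))

-- Joins

data JoinView {n₁ n₂} : Fin (n₁ + n₂) → Set where
  left  : (a : Fin n₁) → JoinView (a ↑ˡ n₂)
  right : (b : Fin n₂) → JoinView (n₁ ↑ʳ b)

joinView : ∀ n₁ n₂ (u : Fin (n₁ + n₂)) → JoinView u
joinView n₁ n₂ u with splitAt n₁ u in eq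
... | inj₁ a = subst JoinView (splitAt⁻¹-↑ˡ eq) (left a)
... | inj₂ b = subst JoinView (splitAt⁻¹-↑ʳ eq) (right b)

↑ˡ≢↑ʳ : ∀ {m n} (i : Fin m) (j : Fin n) → i ↑ˡ n ≢ m ↑ʳ j
↑ˡ≢↑ʳ {m} {n} i j eq with () ← trans (sym (splitAt-↑ˡ m i n)) (trans (cong (splitAt m) eq) (splitAt-↑ʳ m n j))

isLeft : ∀ n₁ {n₂} → Fin (n₁ + n₂) → Bool
isLeft n₁ u = [ const true , const false ]′ (splitAt n₁ u)

isLeft-↑ˡ : ∀ {n₁} n₂ (a : Fin n₁) → isLeft n₁ (a ↑ˡ n₂) ≡ true
isLeft-↑ˡ {n₁} n₂ a rewrite splitAt-↑ˡ n₁ a n₂ = refl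

isLeft-↑ʳ : ∀ n₁ {n₂} (b : Fin n₂) → isLeft n₁ (n₁ ↑ʳ b) ≡ false
isLeft-↑ʳ n₁ {n₂} b rewrite splitAt-↑ʳ n₁ n₂ b = refl

module _ {n₁ n₂} (G₁ : Graph n₁) (G₂ : Graph n₂) where

  adj-↑ˡ↑ˡ : ∀ a a′ → adj (G₁ ⊕ G₂) (a ↑ˡ n₂) (a′ ↑ˡ n₂) ≡ adj G₁ a a′
  adj-↑ˡ↑ˡ a a′ rewrite splitAt-↑ˡ n₁ a n₂ | splitAt-↑ˡ n₁ a′ n₂ = refl

  adj-↑ʳ↑ʳ : ∀ b b′ → adj (G₁ ⊕ G₂) (n₁ ↑ʳ b) (n₁ ↑ʳ b′) ≡ adj G₂ b b′
  adj-↑ʳ↑ʳ b b′ rewrite splitAt-↑ʳ n₁ n₂ b | splitAt-↑ʳ n₁ n₂ b′ = refl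

  adj-↑ˡ↑ʳ : ∀ a b → Adj (G₁ ⊕ G₂) (a ↑ˡ n₂) (n₁ ↑ʳ b)
  adj-↑ˡ↑ʳ a b rewrite splitAt-↑ˡ n₁ a n₂ | splitAt-↑ʳ n₁ n₂ b = refl

  degree-↑ˡ : ∀ {a a′} → Adj G₁ a a′ → suc n₂ ≤ degree (G₁ ⊕ G₂) (a ↑ˡ n₂)
  degree-↑ˡ {a} {a′} aa′ = count-injection ((a′ ↑ˡ n₂) ◂ (n₁ ↑ʳ_))
    (◂-injective (↑ʳ-injective n₁ _ _) (λ b → ↑ˡ≢↑ʳ a′ b ∘ sym)) λ
    { zero    → trans (adj-↑ˡ↑ˡ a a′) aa′
    ; (suc b) → adj-↑ˡ↑ʳ a b }

  degree-↑ʳ : ∀ {b b′} → Adj G₂ b b′ → suc n₁ ≤ degree (G₁ ⊕ G₂) (n₁ ↑ʳ b)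
  degree-↑ʳ {b} {b′} bb′ = count-injection ((n₁ ↑ʳ b′) ◂ (_↑ˡ n₂))
    (◂-injective (↑ˡ-injective n₂ _ _) (λ a → ↑ˡ≢↑ʳ a b′)) λ
    { zero    → trans (adj-↑ʳ↑ʳ b b′) bb′
    ; (suc a) → Adj-sym (G₁ ⊕ G₂) (adj-↑ˡ↑ʳ a b) }

  neighbours-↑ˡ : ∀ {ℓ w u} → Leaf G₁ ℓ → Adj G₁ ℓ w → Adj (G₁ ⊕ G₂) (ℓ ↑ˡ n₂) u →
                  not (isLeft n₁ u) ≡ true ⊎ u ≡ w ↑ˡ n₂
  neighbours-↑ˡ {ℓ} {w} {u} leaf ℓw ℓu with joinView n₁ n₂ u
  ... | left a  = inj₂ (cong (_↑ˡ n₂) (leaf (trans (sym (adj-↑ˡ↑ˡ ℓ a)) ℓu) ℓw))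
  ... | right b = inj₁ (cong not (isLeft-↑ʳ n₁ b))

  neighbours-↑ʳ : ∀ {ℓ w u} → Leaf G₂ ℓ → Adj G₂ ℓ w → Adj (G₁ ⊕ G₂) (n₁ ↑ʳ ℓ) u →
                  isLeft n₁ u ≡ true ⊎ u ≡ n₁ ↑ʳ w
  neighbours-↑ʳ {ℓ} {w} {u} leaf ℓw ℓu with joinView n₁ n₂ u
  ... | left a  = inj₁ (isLeft-↑ˡ n₂ a)
  ... | right b = inj₂ (cong (n₁ ↑ʳ_) (leaf (trans (sym (adj-↑ʳ↑ʳ ℓ b)) ℓu) ℓw))

join-lowerBound : ∀ {n₁ n₂ m k} {G₁ : Graph n₁} {G₂ : Graph n₂} {ℓ₁ w₁ ℓ₂ w₂} →
             Leaf G₁ ℓ₁ → Adj G₁ ℓ₁ w₁ → Leaf G₂ ℓ₂ → Adj G₂ ℓ₂ w₂ → m ≤ n₁ → m ≤ n₂ →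
             CondColouring (G₁ ⊕ G₂) k (suc m) → m + m ≤ k
join-lowerBound {n₁} {n₂} {G₁ = G₁} {G₂} leaf₁ ℓw₁ leaf₂ ℓw₂ m≤n₁ m≤n₂ C = ≤-trans
  (+-mono-≤ (#colours-nearLeaf C (≤-trans (s≤s m≤n₁) (degree-↑ʳ G₁ G₂ ℓw₂)) (neighbours-↑ʳ G₁ G₂ leaf₂ ℓw₂))
            (#colours-nearLeaf C (≤-trans (s≤s m≤n₂) (degree-↑ˡ G₁ G₂ ℓw₁)) (neighbours-↑ˡ G₁ G₂ leaf₁ ℓw₁)))
  (#colours-disjoint {S = isLeft n₁} {S′ = not ∘ isLeft n₁} sides-differ)
  where
  open CondColouring C
  sides-differ : ∀ {u u′} → isLeft n₁ u ≡ true → not (isLeft n₁ u′) ≡ true → colour u ≢ colour u′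
  sides-differ {u} {u′} isL isR with joinView n₁ n₂ u | joinView n₁ n₂ u′
  ... | left a  | right b = proper _ _ (adj-↑ˡ↑ʳ G₁ G₂ a b)
  ... | left a  | left a′ with () ← trans (sym (cong not (isLeft-↑ˡ n₂ a′))) isR
  ... | right b | _       with () ← trans (sym (isLeft-↑ʳ n₁ b)) isL

module _ {n₁ n₂ m} {G₁ : Graph n₁} {G₂ : Graph n₂} (C₁ : ExactColouring G₁ m) (C₂ : ExactColouring G₂ m) where
  private
    module C₁ = ExactColouring C₁
    module C₂ = ExactColouring C₂

  joinColour : Fin (n₁ + n₂) → Fin (m + m)
  joinColour u = join m m (Sum.map C₁.colour C₂.colour (splitAt n₁ u))

  joinColour-↑ˡ : ∀ a → joinColour (a ↑ˡ n₂) ≡ C₁.colour a ↑ˡ m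
  joinColour-↑ˡ a rewrite splitAt-↑ˡ n₁ a n₂ = refl

  joinColour-↑ʳ : ∀ b → joinColour (n₁ ↑ʳ b) ≡ m ↑ʳ C₂.colour b
  joinColour-↑ʳ b rewrite splitAt-↑ʳ n₁ n₂ b = refl

  joinColouring : (∀ a → ∃[ a′ ] Adj G₁ a a′) → (∀ b → ∃[ b′ ] Adj G₂ b b′) → 1 ≤ m →
                  CondColouring (G₁ ⊕ G₂) (m + m) (suc m)
  joinColouring neighbour₁ neighbour₂ 1≤m = record
    { colour = joinColour
    ; r≤k    = +-monoˡ-≤ m 1≤m
    ; surj   = surjective
    ; proper = proper
    ; cond   = λ v → ≤-trans (m⊓n≤n _ _) (sees-all v)
    }
    where
    surjective : ∀ x → ∃[ u ] joinColour u ≡ x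
    surjective x with joinView m m x
    ... | left  y = let a , ca≡y = C₁.surjective y in a ↑ˡ n₂ , trans (joinColour-↑ˡ a) (cong (_↑ˡ m) ca≡y)
    ... | right y = let b , cb≡y = C₂.surjective y in n₁ ↑ʳ b , trans (joinColour-↑ʳ b) (cong (m ↑ʳ_) cb≡y)

    proper : ∀ u v → Adj (G₁ ⊕ G₂) u v → joinColour u ≢ joinColour v
    proper u v uv eq with joinView n₁ n₂ u | joinView n₁ n₂ v
    ... | left a  | left a′  = C₁.proper (trans (sym (adj-↑ˡ↑ˡ G₁ G₂ a a′)) uv)
                                 (↑ˡ-injective m _ _ (trans (sym (joinColour-↑ˡ a)) (trans eq (joinColour-↑ˡ a′))))
    ... | right b | right b′ = C₂.proper (trans (sym (adj-↑ʳ↑ʳ G₁ G₂ b b′)) uv)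
                                 (↑ʳ-injective m _ _ (trans (sym (joinColour-↑ʳ b)) (trans eq (joinColour-↑ʳ b′))))
    ... | left a  | right b  = ↑ˡ≢↑ʳ _ _ (trans (sym (joinColour-↑ˡ a)) (trans eq (joinColour-↑ʳ b)))
    ... | right b | left a   = ↑ˡ≢↑ʳ _ _ (trans (sym (joinColour-↑ˡ a)) (trans (sym eq) (joinColour-↑ʳ b)))

    -- a vertex sees every colour of the other side plus that of a neighbour on its own side
    sees-all : ∀ v → suc m ≤ nbColours (G₁ ⊕ G₂) joinColour v
    sees-all v with joinView n₁ n₂ v
    ... | left a = let a′ , aa′ = neighbour₁ a in
      #colours-injection {c = joinColour} {S = adj (G₁ ⊕ G₂) (a ↑ˡ n₂)}
        ((C₁.colour a′ ↑ˡ m) ◂ (m ↑ʳ_)) (◂-injective (↑ʳ-injective m _ _) (λ y → ↑ˡ≢↑ʳ _ y ∘ sym)) λ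
        { zero    → a′ ↑ˡ n₂ , trans (adj-↑ˡ↑ˡ G₁ G₂ a a′) aa′ , joinColour-↑ˡ a′
        ; (suc y) → let b , cb≡y = C₂.surjective y in
                    n₁ ↑ʳ b , adj-↑ˡ↑ʳ G₁ G₂ a b , trans (joinColour-↑ʳ b) (cong (m ↑ʳ_) cb≡y) }
    ... | right b = let b′ , bb′ = neighbour₂ b in
      #colours-injection {c = joinColour} {S = adj (G₁ ⊕ G₂) (n₁ ↑ʳ b)}
        ((m ↑ʳ C₂.colour b′) ◂ (_↑ˡ m)) (◂-injective (↑ˡ-injective m _ _) (λ y → ↑ˡ≢↑ʳ y _)) λ
        { zero    → n₁ ↑ʳ b′ , trans (adj-↑ʳ↑ʳ G₁ G₂ b b′) bb′ , joinColour-↑ʳ b′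
        ; (suc y) → let a , ca≡y = C₁.surjective y in
                    a ↑ˡ n₂ , Adj-sym (G₁ ⊕ G₂) (adj-↑ˡ↑ʳ G₁ G₂ a b) , trans (joinColour-↑ˡ a) (cong (_↑ˡ m) ca≡y) }

theorem2p2 : ∀ {n₁ n₂} (T₁ : Graph n₁) (T₂ : Graph n₂) →
    Tree T₁ → Tree T₂ → 2 ≤ n₁ → 2 ≤ n₂ → n₁ ≤ n₂ →
    ∀ (r : ℕ) → 4 ≤ r → r ≤ n₁ + 1 →
    ChiR≡ (T₁ ⊕ T₂) r (2 * (r ∸ 1))
theorem2p2 {n₁} {n₂} T₁ T₂ tree₁ tree₂ 2≤n₁ 2≤n₂ n₁≤n₂ (suc m) (s≤s 3≤m) r≤n₁+1
  with tree-pendant tree₁ 2≤n₁ | tree-pendant tree₂ 2≤n₂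
... | _ , _ , leaf₁ , ℓw₁ | _ , _ , leaf₂ , ℓw₂ =
  -- 2 * (suc m ∸ 1) reduces to m + (m + 0)
  subst (ChiR≡ (T₁ ⊕ T₂) (suc m)) (cong (m +_) (sym (+-identityʳ m)))
    ( joinColouring (tree-exactColouring tree₁ 2≤m m≤n₁) (tree-exactColouring tree₂ 2≤m m≤n₂)
                    (neighbour (proj₁ tree₁) 2≤n₁) (neighbour (proj₁ tree₂) 2≤n₂) (≤-trans (n≤1+n 1) 2≤m)
    , λ _ C → join-lowerBound leaf₁ ℓw₁ leaf₂ ℓw₂ m≤n₁ m≤n₂ C )
  where
  2≤m : 2 ≤ m
  2≤m = ≤-trans (n≤1+n 2) 3≤m
  m≤n₁ : m ≤ n₁
  m≤n₁ = ≤-pred (subst (suc m ≤_) (+-comm n₁ 1) r≤n₁+1)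
  m≤n₂ : m ≤ n₂
  m≤n₂ = ≤-trans m≤n₁ n₁≤n₂
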